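{- Let $G$ be a finite simple graph with vertex set $[1,n]$ and no isolated vertices. Then every $G$-ECFF (for every $t$) is also a $G$-CFF if and only if the minimum degree satisfies $\delta(G)\ge2$.
   Context: For a finite simple graph $G$, a family of subsets $B_v\subseteq[1,t]$, one for each vertex $v$ (equivalently a $t\times|V(G)|$ binary matrix with columns indexed by vertices), is a $G$-ECFF$(t,|V(G)|)$ (a $G$-disjunct matrix) if for every edge $\{a,b\}$ and every vertex $w\notin\{a,b\}$, $B_w\not\subseteq B_a\cup B_b$. It is $G$-Sperner if for every edge $\{a,b\}$, $B_a\not\subseteq B_b$ and $B_b\not\subseteq B_a$. It is a $G$-CFF if it is both a $G$-ECFF and $G$-Sperner. -}

module Defs where

open import Data.Nat using (ℕ; _≤_)
open import Data.Bool using (Bool; true; false)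
open import Data.Fin using (Fin)
open import Data.Fin.Subset using (Subset; _⊆_; _∪_; ∣_∣)
open import Data.Vec using (tabulate)
open import Relation.Binary.PropositionalEquality using (_≡_; _≢_)
open import Relation.Nullary using (¬_)
open import Data.Bool using (T)

-- A finite simple graph on the vertex set Fin n (standing for [1,n]),
-- given by a symmetric, loopless Boolean adjacency matrix.
record SimpleGraph (n : ℕ) : Set where
  field
    adj      : Fin n → Fin n → Bool
    symmetric : ∀ u v → adj u v ≡ adj v u
    loopless  : ∀ v → adj v v ≡ false

open SimpleGraph public

Edge : ∀ {n} → SimpleGraph n → Fin n → Fin n → Set
Edge G u v = T (adj G u v)

degree : ∀ {n} → SimpleGraph n → Fin n → ℕ
degree G v = ∣ tabulate (adj G v) ∣

MinDegree≥ : ∀ {n} → SimpleGraph n → ℕ → Set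
MinDegree≥ G k = ∀ v → k ≤ degree G v

NoIsolated : ∀ {n} → SimpleGraph n → Set
NoIsolated G = MinDegree≥ G 1

Family : ℕ → ℕ → Set
Family n t = Fin n → Subset t

IsECFF : ∀ {n t} → SimpleGraph n → Family n t → Set
IsECFF G B = ∀ a b w → Edge G a b → w ≢ a → w ≢ b → ¬ (B w ⊆ (B a ∪ B b))

IsSperner : ∀ {n t} → SimpleGraph n → Family n t → Set
IsSperner G B = ∀ a b → Edge G a b → ¬ (B a ⊆ B b) × ¬ (B b ⊆ B a)
  where open import Data.Product using (_×_)

IsCFF : ∀ {n t} → SimpleGraph n → Family n t → Set
IsCFF G B = IsECFF G B × IsSperner G B
  where open import Data.Product using (_×_)

-- A pendant vertex v, with unique neighbour u, is what breaks the equivalence: putting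
-- B_w = {w} for w ≠ v and B_v = {v, u} gives a G-ECFF (the only way to cover w is
-- w = u ∈ B_v, but then the edge at v must be {v, u} ∋ w) in which B_u ⊆ B_v.
-- Conversely, if δ(G) ≥ 2 and B_a ⊆ B_b for an edge {a, b}, then b has a neighbour
-- y ≠ a, and B_a ⊆ B_b ∪ B_y violates the ECFF condition at the edge {b, y}.
module Submission where

open import Defs
open import Data.Nat using (ℕ; _≤_; _<_; _≤?_)
open import Data.Nat.Properties using (≤-<-trans; <⇒≱; ≤⇒≯; ≰⇒>)
open import Data.Bool using (T)
open import Data.Bool.Properties using (T-≡)
open import Data.Fin using (Fin; _≟_)
open import Data.Fin.Subset using (Subset; _∈_; _⊆_; _∪_; ∣_∣; ⁅_⁆; Nonempty)
open import Data.Fin.Subset.Properties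
  using (nonempty?; Empty-unique; ∣⊥∣≡0; p⊆q⇒∣p∣≤∣q∣; x∈⁅x⁆; x∈⁅y⁆⇒x≡y; ∣⁅x⁆∣≡1;
         x∈p∧x≢y⇒x∈p-y; x∈p⇒∣p-x∣<∣p∣; x∈p∪q⁺; x∈p∪q⁻)
open import Data.Vec using (tabulate)
open import Data.Vec.Properties using ([]=⇒lookup; lookup⇒[]=; lookup∘tabulate)
open import Data.Product using (_×_; _,_; proj₁; proj₂)
open import Data.Sum using (_⊎_; inj₁; inj₂)
open import Data.Empty using (⊥-elim)
open import Function.Base using (_∘_)
open import Function.Bundles using (_⇔_; mk⇔; Equivalence)
open import Relation.Nullary using (¬_; yes; no; contradiction)
open import Relation.Binary.PropositionalEquality using (_≡_; _≢_; refl; sym; trans; subst)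

module _ {n : ℕ} where

  1≤∣p∣⇒Nonempty : ∀ {p : Subset n} → 1 ≤ ∣ p ∣ → Nonempty p
  1≤∣p∣⇒Nonempty {p} 1≤∣p∣ with nonempty? p
  ... | yes ne = ne
  ... | no  ¬ne = contradiction
    (subst (1 ≤_) (∣⊥∣≡0 n) (subst (λ q → 1 ≤ ∣ q ∣) (Empty-unique ¬ne) 1≤∣p∣)) λ ()

  x∈p⇒⁅x⁆⊆p : ∀ {p : Subset n} {x} → x ∈ p → ⁅ x ⁆ ⊆ p
  x∈p⇒⁅x⁆⊆p {p} {x} x∈p y∈⁅x⁆ = subst (_∈ p) (sym (x∈⁅y⁆⇒x≡y x y∈⁅x⁆)) x∈p

  x∈p⇒1≤∣p∣ : ∀ {p : Subset n} {x} → x ∈ p → 1 ≤ ∣ p ∣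
  x∈p⇒1≤∣p∣ {p} {x} x∈p = subst (_≤ ∣ p ∣) (∣⁅x⁆∣≡1 x) (p⊆q⇒∣p∣≤∣q∣ (x∈p⇒⁅x⁆⊆p x∈p))

  x∈p∧y∈p∧x≢y⇒2≤∣p∣ : ∀ {p : Subset n} {x y} → x ∈ p → y ∈ p → x ≢ y → 2 ≤ ∣ p ∣
  x∈p∧y∈p∧x≢y⇒2≤∣p∣ x∈p y∈p x≢y =
    ≤-<-trans (x∈p⇒1≤∣p∣ (x∈p∧x≢y⇒x∈p-y x∈p x≢y)) (x∈p⇒∣p-x∣<∣p∣ y∈p)

  ⊆⁅x⁆⇒∣p∣≤1 : ∀ {p : Subset n} {x} → p ⊆ ⁅ x ⁆ → ∣ p ∣ ≤ 1
  ⊆⁅x⁆⇒∣p∣≤1 {p} {x} p⊆⁅x⁆ = subst (∣ p ∣ ≤_) (∣⁅x⁆∣≡1 x) (p⊆q⇒∣p∣≤∣q∣ p⊆⁅x⁆)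

module _ {n : ℕ} (G : SimpleGraph n) where

  neighbourhood : Fin n → Subset n
  neighbourhood v = tabulate (adj G v)

  ∈-neighbourhood⁻ : ∀ {v x} → x ∈ neighbourhood v → Edge G v x
  ∈-neighbourhood⁻ {v} {x} m =
    Equivalence.from T-≡ (trans (sym (lookup∘tabulate (adj G v) x)) ([]=⇒lookup m))

  ∈-neighbourhood⁺ : ∀ {v x} → Edge G v x → x ∈ neighbourhood v
  ∈-neighbourhood⁺ {v} {x} e =
    lookup⇒[]= x _ (trans (lookup∘tabulate (adj G v) x) (Equivalence.to T-≡ e))

  Edge-sym : ∀ {a b} → Edge G a b → Edge G b a
  Edge-sym {a} {b} = subst T (symmetric G a b)

  Edge-irrefl : ∀ {a b} → Edge G a b → a ≢ b
  Edge-irrefl {a} e refl = subst T (loopless G a) e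

  module _ {v : Fin n} where

    degree<2⇒uniqueNeighbour : ∀ {u} → degree G v < 2 → Edge G v u → ∀ x → Edge G v x → x ≡ u
    degree<2⇒uniqueNeighbour {u} deg<2 vu x vx with x ≟ u
    ... | yes x≡u = x≡u
    ... | no  x≢u = contradiction
      (x∈p∧y∈p∧x≢y⇒2≤∣p∣ (∈-neighbourhood⁺ vx) (∈-neighbourhood⁺ vu) x≢u) (<⇒≱ deg<2)

    uniqueNeighbour⇒degree≤1 : ∀ {u} → (∀ x → Edge G v x → x ≡ u) → degree G v ≤ 1
    uniqueNeighbour⇒degree≤1 {u} unique = ⊆⁅x⁆⇒∣p∣≤1 λ {x} m →
      subst (_∈ ⁅ u ⁆) (sym (unique x (∈-neighbourhood⁻ m))) (x∈⁅x⁆ u)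

module _ {n t : ℕ} (G : SimpleGraph n) {B : Family n t} where

  IsECFF⇒¬⊆ : IsECFF G B → ∀ {a b y} → Edge G b y → a ≢ b → a ≢ y → ¬ (B a ⊆ B b)
  IsECFF⇒¬⊆ ecff {a} {b} {y} by a≢b a≢y Ba⊆Bb =
    ecff b y a by a≢b a≢y (λ m → x∈p∪q⁺ (inj₁ (Ba⊆Bb m)))

module _ {n : ℕ} (v u : Fin n) where

  pendantFamily : Family n n
  pendantFamily w with w ≟ v
  ... | yes _ = ⁅ v ⁆ ∪ ⁅ u ⁆
  ... | no  _ = ⁅ w ⁆

  ∈-pendantFamily⁻ : ∀ {w x} → x ∈ pendantFamily w → x ≡ w ⊎ (w ≡ v × x ≡ u)
  ∈-pendantFamily⁻ {w} m with w ≟ v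
  ... | no  _ = inj₁ (x∈⁅y⁆⇒x≡y w m)
  ... | yes refl with x∈p∪q⁻ ⁅ v ⁆ ⁅ u ⁆ m
  ...   | inj₁ x∈⁅v⁆ = inj₁ (x∈⁅y⁆⇒x≡y v x∈⁅v⁆)
  ...   | inj₂ x∈⁅u⁆ = inj₂ (refl , x∈⁅y⁆⇒x≡y u x∈⁅u⁆)

  w∈pendantFamily-w : ∀ w → w ∈ pendantFamily w
  w∈pendantFamily-w w with w ≟ v
  ... | yes refl = x∈p∪q⁺ (inj₁ (x∈⁅x⁆ v))
  ... | no  _    = x∈⁅x⁆ w

  u∈pendantFamily-v : u ∈ pendantFamily v
  u∈pendantFamily-v with v ≟ v
  ... | yes _   = x∈p∪q⁺ (inj₂ (x∈⁅x⁆ u))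
  ... | no  v≢v = contradiction refl v≢v

  pendantFamily-u⊆v : pendantFamily u ⊆ pendantFamily v
  pendantFamily-u⊆v m with ∈-pendantFamily⁻ {u} m
  ... | inj₁ refl       = u∈pendantFamily-v
  ... | inj₂ (_ , refl) = u∈pendantFamily-v

  module _ (G : SimpleGraph n) (unique : ∀ x → Edge G v x → x ≡ u) where

    nonEndpoint∉pendantFamily : ∀ {a b w} → Edge G a b → w ≢ a → w ≢ b → ¬ (w ∈ pendantFamily a)
    nonEndpoint∉pendantFamily ab w≢a w≢b w∈Ba with ∈-pendantFamily⁻ w∈Ba
    ... | inj₁ w≡a          = w≢a w≡a
    ... | inj₂ (refl , w≡u) = w≢b (trans w≡u (sym (unique _ ab)))

    pendantFamily-IsECFF : IsECFF G pendantFamily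
    pendantFamily-IsECFF a b w ab w≢a w≢b Bw⊆ with x∈p∪q⁻ _ _ (Bw⊆ (w∈pendantFamily-w w))
    ... | inj₁ w∈Ba = nonEndpoint∉pendantFamily ab w≢a w≢b w∈Ba
    ... | inj₂ w∈Bb = nonEndpoint∉pendantFamily (Edge-sym G ab) w≢b w≢a w∈Bb

    pendantFamily-¬IsSperner : Edge G v u → ¬ IsSperner G pendantFamily
    pendantFamily-¬IsSperner vu sperner = proj₁ (sperner u v (Edge-sym G vu)) pendantFamily-u⊆v

module _ {n : ℕ} (G : SimpleGraph n) where

  MinDegree≥2⇒IsECFF⇒IsSperner : MinDegree≥ G 2 →
                                 ∀ {t} {B : Family n t} → IsECFF G B → IsSperner G B
  MinDegree≥2⇒IsECFF⇒IsSperner δ≥2 {B = B} ecff a b ab = ¬⊆ ab , ¬⊆ (Edge-sym G ab)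
    where
    ¬⊆ : ∀ {a b} → Edge G a b → ¬ (B a ⊆ B b)
    ¬⊆ {a} {b} ab Ba⊆Bb = ≤⇒≯ (uniqueNeighbour⇒degree≤1 G onlyNeighbour) (δ≥2 b)
      where
      onlyNeighbour : ∀ y → Edge G b y → y ≡ a
      onlyNeighbour y by with y ≟ a
      ... | yes y≡a = y≡a
      ... | no  y≢a = ⊥-elim (IsECFF⇒¬⊆ G ecff by (Edge-irrefl G ab) (y≢a ∘ sym) Ba⊆Bb)

  pendant⇒¬IsECFF⇒IsSperner : ∀ {v} → 1 ≤ degree G v → degree G v < 2 →
                              ¬ (∀ (B : Family n n) → IsECFF G B → IsSperner G B)
  pendant⇒¬IsECFF⇒IsSperner {v} deg≥1 deg<2 ecff⇒sperner with 1≤∣p∣⇒Nonempty deg≥1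
  ... | u , u∈N[v] = pendantFamily-¬IsSperner v u G unique vu
                       (ecff⇒sperner _ (pendantFamily-IsECFF v u G unique))
    where
    vu : Edge G v u
    vu = ∈-neighbourhood⁻ G u∈N[v]

    unique : ∀ x → Edge G v x → x ≡ u
    unique = degree<2⇒uniqueNeighbour G deg<2 vu

proposition4p12 : (n : ℕ) (G : SimpleGraph n) → NoIsolated G →
    ((t : ℕ) (B : Family n t) → IsECFF G B → IsCFF G B) ⇔ MinDegree≥ G 2
proposition4p12 n G noIsolated = mk⇔ ecff⇒cff⇒δ≥2 δ≥2⇒ecff⇒cff
  where
  ecff⇒cff⇒δ≥2 : ((t : ℕ) (B : Family n t) → IsECFF G B → IsCFF G B) → MinDegree≥ G 2
  ecff⇒cff⇒δ≥2 ecff⇒cff v with 2 ≤? degree G v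
  ... | yes δ≥2 = δ≥2
  ... | no  δ≱2 = contradiction (λ B ecff → proj₂ (ecff⇒cff n B ecff))
                    (pendant⇒¬IsECFF⇒IsSperner G (noIsolated v) (≰⇒> δ≱2))

  δ≥2⇒ecff⇒cff : MinDegree≥ G 2 → (t : ℕ) (B : Family n t) → IsECFF G B → IsCFF G B
  δ≥2⇒ecff⇒cff δ≥2 t B ecff = ecff , MinDegree≥2⇒IsECFF⇒IsSperner G δ≥2 ecff
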